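{- A relation $R\subseteq\{0,1\}^V$ is a delta matroid if and only if its indicator signature is terraced.
   Context: $R$ is a delta matroid if for all $x,y\in R$ and every $i$ with $x_i\ne y_i$ there exists $j$ (not necessarily distinct from $i$) with $x_j\ne y_j$ such that $x^{\{i,j\}}\in R$, where $x^U$ denotes $x$ with the coordinates in $U$ flipped. The indicator signature of $R$ is $F(x)=1$ if $x\in R$ and $0$ otherwise. A partial configuration $p$ of $V$ is an element of $\{0,1\}^{\operatorname{dom}(p)}$, $\operatorname{dom}(p)\subseteq V$; the pinning $F_p$ is the function on $\{0,1\}^{V\setminus\operatorname{dom}(p)}$ given by $F_p(x)=F(x,p)$; $p^{\{i\}}$ is $p$ with coordinate $i$ flipped. A signature $F$ is terraced if for all partial configurations $p$ of $V$ and all $i,j\in\operatorname{dom}(p)$, if $F_p$ is identically zero then $F_{p^{\{i\}}}$ and $F_{p^{\{j\}}}$ are linearly dependent (one is a scalar multiple of the other). -}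

module Defs where

open import Data.Nat using (ℕ)
open import Data.Bool using (Bool; not; if_then_else_)
open import Data.Maybe using (Maybe; nothing; fromMaybe)
import Data.Maybe as Maybe
open import Data.Fin using (Fin; _≟_)
open import Data.Vec using (Vec; lookup; tabulate)
open import Data.Rational using (ℚ; 0ℚ; 1ℚ; _*_)
open import Data.Product using (∃; _×_)
open import Data.Sum using (_⊎_)
open import Relation.Nullary using (does)
open import Relation.Unary using (Pred; Decidable)
open import Relation.Binary.PropositionalEquality using (_≡_; _≢_)
open import Level using (0ℓ)

-- The ground set V is Fin n; a configuration x ∈ {0,1}^V is a Vec Bool n.
Config : ℕ → Set
Config n = Vec Bool n

Signature : ℕ → Set
Signature n = Config n → ℚ

-- x^{i,j}: flip coordinates i and j (if i = j, only coordinate i is flipped).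
flip2 : ∀ {n} → Config n → Fin n → Fin n → Config n
flip2 x i j = tabulate λ k →
  if does (k ≟ i) then not (lookup x k)
  else if does (k ≟ j) then not (lookup x k)
  else lookup x k

IsDeltaMatroid : ∀ {n} → Pred (Config n) 0ℓ → Set
IsDeltaMatroid {n} R =
  ∀ (x y : Config n) → R x → R y → ∀ (i : Fin n) → lookup x i ≢ lookup y i →
  ∃ λ (j : Fin n) → lookup x j ≢ lookup y j × R (flip2 x i j)

indicator : ∀ {n} {R : Pred (Config n) 0ℓ} → Decidable R → Signature n
indicator R? x = if does (R? x) then 1ℚ else 0ℚ

-- Partial configuration: entry k is nothing if k ∉ dom(p), just b if p(k) = b.
PartialConfig : ℕ → Set
PartialConfig n = Vec (Maybe Bool) n

-- (x, p): the full configuration agreeing with p on dom(p) and with x elsewhere.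
-- The coordinates of x in dom(p) are ignored, so functions of x ↦ F (merge p x)
-- represent functions on {0,1}^{V ∖ dom(p)}.
merge : ∀ {n} → PartialConfig n → Config n → Config n
merge p x = tabulate λ k → fromMaybe (lookup x k) (lookup p k)

pin : ∀ {n} → Signature n → PartialConfig n → Config n → ℚ
pin F p x = F (merge p x)

flipP : ∀ {n} → PartialConfig n → Fin n → PartialConfig n
flipP p i = tabulate λ k →
  if does (k ≟ i) then Maybe.map not (lookup p k) else lookup p k

_∈dom_ : ∀ {n} → Fin n → PartialConfig n → Set
i ∈dom p = lookup p i ≢ nothing

LinDep : ∀ {n} → (Config n → ℚ) → (Config n → ℚ) → Set
LinDep {n} f g =
  (∃ λ (c : ℚ) → ∀ (x : Config n) → f x ≡ c * g x)
  ⊎ (∃ λ (c : ℚ) → ∀ (x : Config n) → g x ≡ c * f x)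

Terraced : ∀ {n} → Signature n → Set
Terraced {n} F =
  ∀ (p : PartialConfig n) (i j : Fin n) → i ∈dom p → j ∈dom p →
  (∀ (x : Config n) → pin F p x ≡ 0ℚ) →
  LinDep (pin F (flipP p i)) (pin F (flipP p j))

module Submission where

--  * Pinning commutes with flipping: for i ∈ dom p, (x, p^{i}) = (x, p)^{i}.
--    Hence all completions that occur are obtained from a completion of p by
--    flipping one or two coordinates, and are handled by a small algebra of
--    flips (toggle, flip2) and completions (merge, restrict).
--  * (⇒) If no completion of p lies in R and i ≠ j ∈ dom p, the delta matroid
--    axiom applied to (x, p^{i}) and (y, p^{j}) at coordinate i can only be
--    answered by j, giving (x, p^{j}) ∈ R.  So F_{p^{i}} and F_{p^{j}} are
--    equal, unless one of them vanishes; either way they are dependent.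
--  * (⇐) By induction on the Hamming distance of x and y.  If x^{i} ∉ R pick
--    j ≠ i with x_j ≠ y_j and pin the coordinates i, j and those where x and
--    y agree to their values in x^{i}.  A completion of this pinning in R is
--    closer to x than y is, and induction applies; otherwise F_p vanishes,
--    terracedness makes F_{p^{i}} and F_{p^{j}} dependent, and since
--    (x, p^{i}) = x and (y, p^{j}) = y lie in R, so does (x, p^{j}) = x^{i,j}.

open import Defs
open import Data.Nat using (ℕ; zero; suc; _+_; _≤_; _<_; z≤n; s≤s)
open import Data.Nat.Properties using (≤-refl; +-mono-≤; +-mono-≤-<; <-≤-trans; ≤-pred)
open import Level using (Level; 0ℓ)
open import Relation.Unary using (Pred; Decidable)
open import Relation.Binary.Definitions using (DecidableEquality)
open import Function.Bundles using (_⇔_; mk⇔)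
open import Data.Bool using (Bool; true; false; not; if_then_else_)
import Data.Bool as Bool
open import Data.Bool.Properties using (not-involutive; not-¬; ¬-not)
open import Data.Maybe using (just; nothing; fromMaybe)
import Data.Maybe as Maybe
open import Data.Maybe.Properties using (just-injective)
open import Data.Fin using (Fin; _≟_)
open import Data.Fin.Properties using (any?)
open import Data.Vec using (Vec; []; _∷_; lookup; tabulate)
open import Data.Vec.Properties using (lookup∘tabulate)
open import Data.Vec.Relation.Binary.Pointwise.Extensional using (ext; Pointwise-≡⇒≡)
open import Data.Rational using (ℚ; 0ℚ; 1ℚ; _*_)
open import Data.Rational.Properties using (*-zeroˡ; *-zeroʳ; *-identityˡ; *-identityʳ; 1≢0)
open import Data.Product using (∃; _×_; _,_)
open import Data.Sum using (_⊎_; inj₁; inj₂; swap)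
open import Data.Empty using (⊥-elim)
open import Relation.Nullary using (Dec; yes; no; does; ¬_; ¬?; _×-dec_; _⊎-dec_)
open import Relation.Nullary.Decidable using (dec-true; dec-false; map′)
open import Relation.Binary.PropositionalEquality
open ≡-Reasoning

private
  variable
    n : ℕ
    ℓ : Level

vec-ext : ∀ {A : Set} {u v : Vec A n} → (∀ k → lookup u k ≡ lookup v k) → u ≡ v
vec-ext h = Pointwise-≡⇒≡ (ext h)

any-config? : {P : Pred (Config n) ℓ} → Decidable P → Dec (∃ P)
any-config? {zero} P? = map′ ([] ,_) (λ { ([] , p) → p }) (P? [])
any-config? {suc n} {P = P} P? =
  map′ extend split (any-config? (λ xs → P? (true ∷ xs) ⊎-dec P? (false ∷ xs)))
  where
  extend : ∃ (λ xs → P (true ∷ xs) ⊎ P (false ∷ xs)) → ∃ P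
  extend (xs , inj₁ p) = true ∷ xs , p
  extend (xs , inj₂ p) = false ∷ xs , p
  split : ∃ P → ∃ (λ xs → P (true ∷ xs) ⊎ P (false ∷ xs))
  split (true ∷ xs , p) = xs , inj₁ p
  split (false ∷ xs , p) = xs , inj₂ p

toggle : Config n → Fin n → Config n
toggle x i = flip2 x i i

lookup-flip2 : (x : Config n) (i j k : Fin n) →
  lookup (flip2 x i j) k ≡
    (if does (k ≟ i) then not (lookup x k)
     else if does (k ≟ j) then not (lookup x k) else lookup x k)
lookup-flip2 x i j k = lookup∘tabulate _ k

flip2-first : (x : Config n) (i j : Fin n) → lookup (flip2 x i j) i ≡ not (lookup x i)
flip2-first x i j rewrite lookup-flip2 x i j i | dec-true (i ≟ i) refl = refl

flip2-second : (x : Config n) {i j : Fin n} → j ≢ i → lookup (flip2 x i j) j ≡ not (lookup x j)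
flip2-second x {i} {j} j≢i
  rewrite lookup-flip2 x i j j | dec-false (j ≟ i) j≢i | dec-true (j ≟ j) refl = refl

flip2-other : (x : Config n) {i j k : Fin n} → k ≢ i → k ≢ j → lookup (flip2 x i j) k ≡ lookup x k
flip2-other x {i} {j} {k} k≢i k≢j
  rewrite lookup-flip2 x i j k | dec-false (k ≟ i) k≢i | dec-false (k ≟ j) k≢j = refl

toggle-at : (x : Config n) (i : Fin n) → lookup (toggle x i) i ≡ not (lookup x i)
toggle-at x i = flip2-first x i i

toggle-other : (x : Config n) {i k : Fin n} → k ≢ i → lookup (toggle x i) k ≡ lookup x k
toggle-other x k≢i = flip2-other x k≢i k≢i

toggle-involutive : (x : Config n) (i : Fin n) → toggle (toggle x i) i ≡ x
toggle-involutive x i = vec-ext entry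
  where
  entry : ∀ k → lookup (toggle (toggle x i) i) k ≡ lookup x k
  entry k with k ≟ i
  ... | yes refl = trans (toggle-at (toggle x k) k)
                         (trans (cong not (toggle-at x k)) (not-involutive _))
  ... | no k≢i = trans (toggle-other (toggle x i) k≢i) (toggle-other x k≢i)

toggle-toggle : (x : Config n) {i j : Fin n} → i ≢ j → toggle (toggle x i) j ≡ flip2 x i j
toggle-toggle x {i} {j} i≢j = vec-ext entry
  where
  entry : ∀ k → lookup (toggle (toggle x i) j) k ≡ lookup (flip2 x i j) k
  entry k with k ≟ i | k ≟ j
  ... | yes refl | _ = trans (toggle-other (toggle x k) i≢j)
                             (trans (toggle-at x k) (sym (flip2-first x k j)))
  ... | no k≢i | yes refl = trans (toggle-at (toggle x i) k)
                                  (trans (cong not (toggle-other x k≢i)) (sym (flip2-second x k≢i)))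
  ... | no k≢i | no k≢j = trans (toggle-other (toggle x i) k≢j)
                                (trans (toggle-other x k≢i) (sym (flip2-other x k≢i k≢j)))

flip2-after-toggle : (x : Config n) {i j : Fin n} → i ≢ j → flip2 (toggle x i) i j ≡ toggle x j
flip2-after-toggle x {i} {j} i≢j = begin
  flip2 (toggle x i) i j           ≡⟨ sym (toggle-toggle (toggle x i) i≢j) ⟩
  toggle (toggle (toggle x i) i) j ≡⟨ cong (λ v → toggle v j) (toggle-involutive x i) ⟩
  toggle x j                       ∎

differs-only-at : (x y : Config n) (i : Fin n) → lookup x i ≢ lookup y i →
  (∀ k → k ≢ i → lookup x k ≡ lookup y k) → y ≡ toggle x i
differs-only-at x y i xi≢yi agree = vec-ext entry
  where
  entry : ∀ k → lookup y k ≡ lookup (toggle x i) k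
  entry k with k ≟ i
  ... | yes refl = trans (¬-not (≢-sym xi≢yi)) (sym (toggle-at x k))
  ... | no k≢i = trans (sym (agree k k≢i)) (sym (toggle-other x k≢i))

another-difference : (x y : Config n) (i : Fin n) → lookup x i ≢ lookup y i →
  y ≡ toggle x i ⊎ ∃ λ j → j ≢ i × lookup x j ≢ lookup y j
another-difference x y i xi≢yi with any? (λ j → ¬? (j ≟ i) ×-dec ¬? (lookup x j Bool.≟ lookup y j))
... | yes difference = inj₂ difference
... | no none = inj₁ (differs-only-at x y i xi≢yi agree)
  where
  agree : ∀ k → k ≢ i → lookup x k ≡ lookup y k
  agree k k≢i with lookup x k Bool.≟ lookup y k
  ... | yes e = e
  ... | no d = ⊥-elim (none (k , k≢i , d))

just-in-dom : (p : PartialConfig n) (i : Fin n) {b : Bool} → lookup p i ≡ just b → i ∈dom p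
just-in-dom p i e e′ with () ← trans (sym e) e′

dom-value : (p : PartialConfig n) {i : Fin n} → i ∈dom p → ∃ λ b → lookup p i ≡ just b
dom-value p {i} i∈p with lookup p i
... | just b = b , refl
... | nothing = ⊥-elim (i∈p refl)

lookup-merge : (p : PartialConfig n) (x : Config n) (k : Fin n) →
  lookup (merge p x) k ≡ fromMaybe (lookup x k) (lookup p k)
lookup-merge p x k = lookup∘tabulate _ k

merge-fixed : (p : PartialConfig n) (x : Config n) {k : Fin n} {b : Bool} →
  lookup p k ≡ just b → lookup (merge p x) k ≡ b
merge-fixed p x {k} e = trans (lookup-merge p x k) (cong (fromMaybe (lookup x k)) e)

merge-free : (p : PartialConfig n) (x : Config n) {k : Fin n} →
  lookup p k ≡ nothing → lookup (merge p x) k ≡ lookup x k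
merge-free p x {k} e = trans (lookup-merge p x k) (cong (fromMaybe (lookup x k)) e)

merge-on-dom : (p : PartialConfig n) (x y : Config n) {k : Fin n} → k ∈dom p →
  lookup (merge p x) k ≡ lookup (merge p y) k
merge-on-dom p x y k∈p with dom-value p k∈p
... | b , e = trans (merge-fixed p x e) (sym (merge-fixed p y e))

merge-unique : (p : PartialConfig n) (x v : Config n) →
  (∀ k b → lookup p k ≡ just b → lookup v k ≡ b) →
  (∀ k → lookup p k ≡ nothing → lookup v k ≡ lookup x k) → merge p x ≡ v
merge-unique p x v on-dom off-dom = vec-ext entry
  where
  entry : ∀ k → lookup (merge p x) k ≡ lookup v k
  entry k with lookup p k in e
  ... | just b = trans (merge-fixed p x e) (sym (on-dom k b e))
  ... | nothing = trans (merge-free p x e) (sym (off-dom k e))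

lookup-flipP-at : (p : PartialConfig n) (i : Fin n) → lookup (flipP p i) i ≡ Maybe.map not (lookup p i)
lookup-flipP-at p i rewrite lookup∘tabulate
  (λ k → if does (k ≟ i) then Maybe.map not (lookup p k) else lookup p k) i
  | dec-true (i ≟ i) refl = refl

lookup-flipP-other : (p : PartialConfig n) {i k : Fin n} → k ≢ i → lookup (flipP p i) k ≡ lookup p k
lookup-flipP-other p {i} {k} k≢i rewrite lookup∘tabulate
  (λ l → if does (l ≟ i) then Maybe.map not (lookup p l) else lookup p l) k
  | dec-false (k ≟ i) k≢i = refl

merge-flipP : (p : PartialConfig n) (x : Config n) {i : Fin n} → i ∈dom p →
  merge (flipP p i) x ≡ toggle (merge p x) i
merge-flipP p x {i} i∈p = vec-ext entry
  where
  entry : ∀ k → lookup (merge (flipP p i) x) k ≡ lookup (toggle (merge p x) i) k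
  entry k with k ≟ i
  ... | yes refl with dom-value p i∈p
  ...   | b , e = trans (merge-fixed (flipP p k) x (trans (lookup-flipP-at p k) (cong (Maybe.map not) e)))
                        (sym (trans (toggle-at (merge p x) k) (cong not (merge-fixed p x e))))
  entry k | no k≢i = begin
    lookup (merge (flipP p i) x) k          ≡⟨ lookup-merge (flipP p i) x k ⟩
    fromMaybe (lookup x k) (lookup (flipP p i) k) ≡⟨ cong (fromMaybe (lookup x k)) (lookup-flipP-other p k≢i) ⟩
    fromMaybe (lookup x k) (lookup p k)     ≡⟨ sym (lookup-merge p x k) ⟩
    lookup (merge p x) k                    ≡⟨ sym (toggle-other (merge p x) k≢i) ⟩
    lookup (toggle (merge p x) i) k         ∎

toggle-free : (p : PartialConfig n) (x : Config n) {k : Fin n} → lookup p k ≡ nothing →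
  toggle (merge p x) k ≡ merge p (toggle x k)
toggle-free p x {k} free = sym (merge-unique p (toggle x k) (toggle (merge p x) k) on-dom off-dom)
  where
  on-dom : ∀ l b → lookup p l ≡ just b → lookup (toggle (merge p x) k) l ≡ b
  on-dom l b e with l ≟ k
  ... | yes refl with () ← trans (sym e) free
  ... | no l≢k = trans (toggle-other (merge p x) l≢k) (merge-fixed p x e)
  off-dom : ∀ l → lookup p l ≡ nothing → lookup (toggle (merge p x) k) l ≡ lookup (toggle x k) l
  off-dom l e with l ≟ k
  ... | yes refl = trans (toggle-at (merge p x) l) (trans (cong not (merge-free p x e)) (sym (toggle-at x l)))
  ... | no l≢k = trans (toggle-other (merge p x) l≢k) (trans (merge-free p x e) (sym (toggle-other x l≢k)))

restrict : Config n → {P : Pred (Fin n) ℓ} → Decidable P → PartialConfig n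
restrict w P? = tabulate λ k → if does (P? k) then just (lookup w k) else nothing

restrict-in : (w : Config n) {P : Pred (Fin n) ℓ} (P? : Decidable P) {k : Fin n} →
  P k → lookup (restrict w P?) k ≡ just (lookup w k)
restrict-in w P? {k} Pk rewrite lookup∘tabulate
  (λ l → if does (P? l) then just (lookup w l) else nothing) k | dec-true (P? k) Pk = refl

restrict-out : (w : Config n) {P : Pred (Fin n) ℓ} (P? : Decidable P) {k : Fin n} →
  ¬ P k → lookup (restrict w P?) k ≡ nothing
restrict-out w P? {k} ¬Pk rewrite lookup∘tabulate
  (λ l → if does (P? l) then just (lookup w l) else nothing) k | dec-false (P? k) ¬Pk = refl

merge-restrict : (w z v : Config n) {P : Pred (Fin n) ℓ} (P? : Decidable P) →
  (∀ k → P k → lookup v k ≡ lookup w k) → (∀ k → ¬ P k → lookup v k ≡ lookup z k) →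
  merge (restrict w P?) z ≡ v
merge-restrict w z v P? inside outside = merge-unique (restrict w P?) z v on-dom off-dom
  where
  on-dom : ∀ k b → lookup (restrict w P?) k ≡ just b → lookup v k ≡ b
  on-dom k b e with P? k
  ... | yes Pk = trans (inside k Pk) (just-injective (trans (sym (restrict-in w P? Pk)) e))
  ... | no ¬Pk with () ← trans (sym (restrict-out w P? ¬Pk)) e
  off-dom : ∀ k → lookup (restrict w P?) k ≡ nothing → lookup v k ≡ lookup z k
  off-dom k e with P? k
  ... | yes Pk with () ← trans (sym (restrict-in w P? Pk)) e
  ... | no ¬Pk = outside k ¬Pk

module Hamming {A : Set} (_≟A_ : DecidableEquality A) where

  mismatch : A → A → ℕ
  mismatch a b = if does (a ≟A b) then 0 else 1

  distance : Vec A n → Vec A n → ℕ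
  distance [] [] = 0
  distance (a ∷ as) (b ∷ bs) = mismatch a b + distance as bs

  mismatch-mono : (a b c : A) → (a ≢ c → a ≢ b) → mismatch a c ≤ mismatch a b
  mismatch-mono a b c h with a ≟A c
  ... | yes _ = z≤n
  ... | no a≢c rewrite dec-false (a ≟A b) (h a≢c) = ≤-refl

  mismatch-strict : (a b : A) → a ≢ b → mismatch a a < mismatch a b
  mismatch-strict a b a≢b rewrite dec-true (a ≟A a) refl | dec-false (a ≟A b) a≢b = s≤s z≤n

  distance-mono : (x w y : Vec A n) → (∀ k → lookup x k ≢ lookup w k → lookup x k ≢ lookup y k) →
    distance x w ≤ distance x y
  distance-mono [] [] [] _ = z≤n
  distance-mono (a ∷ x) (c ∷ w) (b ∷ y) h =
    +-mono-≤ (mismatch-mono a b c (h Fin.zero)) (distance-mono x w y (λ k → h (Fin.suc k)))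

  distance-strict : (x w y : Vec A n) → (∀ k → lookup x k ≢ lookup w k → lookup x k ≢ lookup y k) →
    ∀ j → lookup x j ≡ lookup w j → lookup x j ≢ lookup y j → distance x w < distance x y
  distance-strict (a ∷ x) (.a ∷ w) (b ∷ y) h Fin.zero refl a≢b =
    +-mono-≤ (mismatch-strict a b a≢b) (distance-mono x w y (λ k → h (Fin.suc k)))
  distance-strict (a ∷ x) (c ∷ w) (b ∷ y) h (Fin.suc j) e ne =
    +-mono-≤-< (mismatch-mono a b c (h Fin.zero)) (distance-strict x w y (λ k → h (Fin.suc k)) j e ne)

open Hamming Bool._≟_ using (distance; distance-strict)

linDep-zero : (f g : Config n → ℚ) → (∀ x → f x ≡ 0ℚ) → LinDep f g
linDep-zero f g f≡0 = inj₁ (0ℚ , λ x → trans (f≡0 x) (sym (*-zeroˡ (g x))))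

linDep-equal : (f g : Config n → ℚ) → (∀ x → f x ≡ g x) → LinDep f g
linDep-equal f g f≡g = inj₁ (1ℚ , λ x → trans (f≡g x) (sym (*-identityˡ (g x))))

linDep-support : (f g : Config n → ℚ) → LinDep f g → ∀ x y →
  f x ≡ 1ℚ → g y ≢ 0ℚ → g x ≢ 0ℚ
linDep-support f g (inj₁ (c , f≡cg)) x y fx≡1 _ gx≡0 =
  1≢0 (trans (sym fx≡1) (trans (f≡cg x) (trans (cong (c *_) gx≡0) (*-zeroʳ c))))
linDep-support f g (inj₂ (c , g≡cf)) x y fx≡1 gy≢0 gx≡0 =
  gy≢0 (trans (g≡cf y) (trans (cong (_* f y) c≡0) (*-zeroˡ (f y))))
  where
  c≡0 : c ≡ 0ℚ
  c≡0 = begin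
    c          ≡⟨ sym (*-identityʳ c) ⟩
    c * 1ℚ     ≡⟨ cong (c *_) (sym fx≡1) ⟩
    c * f x    ≡⟨ sym (g≡cf x) ⟩
    g x        ≡⟨ gx≡0 ⟩
    0ℚ         ∎

module _ {n : ℕ} {R : Pred (Config n) 0ℓ} (R? : Decidable R) where

  private
    F : Signature n
    F = indicator R?

  indicator-in : ∀ {x} → R x → F x ≡ 1ℚ
  indicator-in {x} r with R? x
  ... | yes _ = refl
  ... | no ¬r = ⊥-elim (¬r r)

  indicator-out : ∀ {x} → ¬ R x → F x ≡ 0ℚ
  indicator-out {x} ¬r with R? x
  ... | yes r = ⊥-elim (¬r r)
  ... | no _ = refl

  indicator-nonzero : ∀ {x} → F x ≢ 0ℚ → R x
  indicator-nonzero {x} Fx≢0 with R? x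
  ... | yes r = r
  ... | no _ = ⊥-elim (Fx≢0 refl)

  indicator-cong : ∀ {x y} → (R x → R y) → (R y → R x) → F x ≡ F y
  indicator-cong {x} {y} x⇒y y⇒x with R? x
  ... | yes r = sym (indicator-in (x⇒y r))
  ... | no ¬r = sym (indicator-out (λ r → ¬r (y⇒x r)))

  DeltaStep : Config n → Config n → Fin n → Set
  DeltaStep x y i = ∃ λ j → lookup x j ≢ lookup y j × R (flip2 x i j)

  exchange : IsDeltaMatroid R → (p : PartialConfig n) → (∀ z → ¬ R (merge p z)) →
    {i j : Fin n} → i ≢ j → i ∈dom p → j ∈dom p → (x y : Config n) →
    R (merge (flipP p i) x) → R (merge (flipP p j) y) → R (merge (flipP p j) x)
  exchange dm p empty {i} {j} i≢j i∈p j∈p x y rX rY =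
    subst R (sym (merge-flipP p x j∈p))
      (answer (dm X Y (subst R (merge-flipP p x i∈p) rX) (subst R (merge-flipP p y j∈p) rY) i Xi≢Yi))
    where
    X Y : Config n
    X = toggle (merge p x) i
    Y = toggle (merge p y) j
    Xi≢Yi : lookup X i ≢ lookup Y i
    Xi≢Yi e = not-¬ (merge-on-dom p y x i∈p)
      (trans (sym (toggle-other (merge p y) i≢j)) (trans (sym e) (toggle-at (merge p x) i)))
    -- The only answer the axiom can give at coordinate i is j.
    answer : DeltaStep X Y i → R (toggle (merge p x) j)
    answer (k , Xk≢Yk , r) with k ≟ i
    ... | yes refl = ⊥-elim (empty x (subst R (toggle-involutive (merge p x) k) r))
    ... | no k≢i with k ≟ j
    ...   | yes refl = subst R (flip2-after-toggle (merge p x) i≢j) r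
    ...   | no k≢j with lookup p k in e
    ...     | nothing = ⊥-elim (empty (toggle x k)
                (subst R (trans (flip2-after-toggle (merge p x) (λ i≡k → k≢i (sym i≡k))) (toggle-free p x e)) r))
    ...     | just _ = ⊥-elim (Xk≢Yk (begin
                lookup X k            ≡⟨ toggle-other (merge p x) k≢i ⟩
                lookup (merge p x) k  ≡⟨ merge-on-dom p x y (just-in-dom p k e) ⟩
                lookup (merge p y) k  ≡⟨ sym (toggle-other (merge p y) k≢j) ⟩
                lookup Y k            ∎))

  deltaMatroid⇒terraced : IsDeltaMatroid R → Terraced F
  deltaMatroid⇒terraced dm p i j i∈p j∈p vanish with i ≟ j
  ... | yes refl = linDep-equal (pin F (flipP p i)) (pin F (flipP p i)) (λ _ → refl)
  ... | no i≢j with any-config? (λ z → R? (merge (flipP p i) z))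
                  | any-config? (λ z → R? (merge (flipP p j) z))
  ...   | no noneᵢ | _ = linDep-zero (pin F (flipP p i)) (pin F (flipP p j))
            (λ z → indicator-out (λ r → noneᵢ (z , r)))
  ...   | yes _ | no noneⱼ = swap (linDep-zero (pin F (flipP p j)) (pin F (flipP p i))
            (λ z → indicator-out (λ r → noneⱼ (z , r))))
  ...   | yes (zᵢ , rᵢ) | yes (zⱼ , rⱼ) = linDep-equal (pin F (flipP p i)) (pin F (flipP p j))
            (λ x → indicator-cong (λ r → exchange dm p empty i≢j i∈p j∈p x zⱼ r rⱼ)
                                  (λ r → exchange dm p empty (≢-sym i≢j) j∈p i∈p x zᵢ r rᵢ))
    where
    empty : ∀ z → ¬ R (merge p z)
    empty z r = 1≢0 (trans (sym (indicator-in r)) (vanish z))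

  module Augmentation (x y : Config n) {i j : Fin n} (j≢i : j ≢ i)
                      (xi≢yi : lookup x i ≢ lookup y i) (xj≢yj : lookup x j ≢ lookup y j) where

    Pinned : Pred (Fin n) 0ℓ
    Pinned k = k ≡ i ⊎ k ≡ j ⊎ lookup x k ≡ lookup y k

    pinned? : Decidable Pinned
    pinned? k = k ≟ i ⊎-dec k ≟ j ⊎-dec lookup x k Bool.≟ lookup y k

    p : PartialConfig n
    p = restrict (toggle x i) pinned?

    pinned-value : ∀ {k} → Pinned k → lookup p k ≡ just (lookup (toggle x i) k)
    pinned-value = restrict-in (toggle x i) pinned?

    i∈p : i ∈dom p
    i∈p = just-in-dom p i (pinned-value (inj₁ refl))

    j∈p : j ∈dom p
    j∈p = just-in-dom p j (pinned-value (inj₂ (inj₁ refl)))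

    x-completes : merge p x ≡ toggle x i
    x-completes = merge-restrict (toggle x i) x (toggle x i) pinned? (λ _ _ → refl)
      (λ k ¬P → toggle-other x (λ k≡i → ¬P (inj₁ k≡i)))

    y-completes : merge p y ≡ toggle y j
    y-completes = merge-restrict (toggle x i) y (toggle y j) pinned? inside
      (λ k ¬P → toggle-other y (λ k≡j → ¬P (inj₂ (inj₁ k≡j))))
      where
      inside : ∀ k → Pinned k → lookup (toggle y j) k ≡ lookup (toggle x i) k
      inside k (inj₁ refl) = trans (toggle-other y (λ k≡j → j≢i (sym k≡j)))
                                   (trans (¬-not (≢-sym xi≢yi)) (sym (toggle-at x k)))
      inside k (inj₂ (inj₁ refl)) = trans (toggle-at y k)
                                          (trans (sym (¬-not xj≢yj)) (sym (toggle-other x j≢i)))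
      inside k (inj₂ (inj₂ xk≡yk)) with k ≟ i | k ≟ j
      ... | yes refl | _ = ⊥-elim (xi≢yi xk≡yk)
      ... | no _ | yes refl = ⊥-elim (xj≢yj xk≡yk)
      ... | no k≢i | no k≢j = trans (toggle-other y k≢j) (trans (sym xk≡yk) (sym (toggle-other x k≢i)))

    x-at-i : merge (flipP p i) x ≡ x
    x-at-i = begin
      merge (flipP p i) x      ≡⟨ merge-flipP p x i∈p ⟩
      toggle (merge p x) i     ≡⟨ cong (λ v → toggle v i) x-completes ⟩
      toggle (toggle x i) i    ≡⟨ toggle-involutive x i ⟩
      x                        ∎

    y-at-j : merge (flipP p j) y ≡ y
    y-at-j = begin
      merge (flipP p j) y      ≡⟨ merge-flipP p y j∈p ⟩
      toggle (merge p y) j     ≡⟨ cong (λ v → toggle v j) y-completes ⟩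
      toggle (toggle y j) j    ≡⟨ toggle-involutive y j ⟩
      y                        ∎

    x-at-j : merge (flipP p j) x ≡ flip2 x i j
    x-at-j = begin
      merge (flipP p j) x      ≡⟨ merge-flipP p x j∈p ⟩
      toggle (merge p x) j     ≡⟨ cong (λ v → toggle v j) x-completes ⟩
      toggle (toggle x i) j    ≡⟨ toggle-toggle x (λ i≡j → j≢i (sym i≡j)) ⟩
      flip2 x i j              ∎

    completion-between : ∀ z k → lookup x k ≢ lookup (merge p z) k → lookup x k ≢ lookup y k
    completion-between z k xk≢wk with k ≟ i
    ... | yes refl = xi≢yi
    ... | no k≢i = λ xk≡yk → xk≢wk (sym (trans (merge-fixed p z (pinned-value (inj₂ (inj₂ xk≡yk))))
                                                  (toggle-other x k≢i)))

    completion-at-j : ∀ z → lookup x j ≡ lookup (merge p z) j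
    completion-at-j z = sym (trans (merge-fixed p z (pinned-value (inj₂ (inj₁ refl)))) (toggle-other x j≢i))

    completion-at-i : ∀ z → lookup x i ≢ lookup (merge p z) i
    completion-at-i z e = not-¬ refl (trans e (trans (merge-fixed p z (pinned-value (inj₁ refl))) (toggle-at x i)))

    -- Either a completion of p in R is strictly closer to x than y, and the
    -- step for it (supplied by induction) is also a step towards y; or none
    -- is, and terracedness transfers membership from (x, p^{i}) = x and
    -- (y, p^{j}) = y to (x, p^{j}) = x^{i,j}.
    step : Terraced F → R x → R y →
      (∀ w → R w → distance x w < distance x y → lookup x i ≢ lookup w i → DeltaStep x w i) →
      DeltaStep x y i
    step te rx ry closer-step with any-config? (λ z → R? (merge p z))
    ... | yes (z , rw) = widen (closer-step (merge p z) rw closer (completion-at-i z))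
      where
      closer : distance x (merge p z) < distance x y
      closer = distance-strict x (merge p z) y (completion-between z) j (completion-at-j z) xj≢yj
      widen : DeltaStep x (merge p z) i → DeltaStep x y i
      widen (k , xk≢wk , r) = k , completion-between z k xk≢wk , r
    ... | no empty = j , xj≢yj , subst R x-at-j (indicator-nonzero Fxj≢0)
      where
      Fxj≢0 : F (merge (flipP p j) x) ≢ 0ℚ
      Fxj≢0 = linDep-support (pin F (flipP p i)) (pin F (flipP p j))
        (te p i j i∈p j∈p (λ z → indicator-out (λ r → empty (z , r))))
        x y (indicator-in (subst R (sym x-at-i) rx))
        (λ e → 1≢0 (trans (sym (indicator-in (subst R (sym y-at-j) ry))) e))

  -- Induction on the distance from x, bounded by m to make it structural.
  augment : Terraced F → (x : Config n) → R x → ∀ m (y : Config n) → R y → distance x y < m →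
    ∀ i → lookup x i ≢ lookup y i → DeltaStep x y i
  augment te x rx (suc m) y ry y<m i xi≢yi with R? (toggle x i) | another-difference x y i xi≢yi
  ... | yes r | _ = i , xi≢yi , r
  ... | no ¬r | inj₁ y≡xⁱ = ⊥-elim (¬r (subst R y≡xⁱ ry))
  ... | no _ | inj₂ (j , j≢i , xj≢yj) = Augmentation.step x y j≢i xi≢yi xj≢yj te rx ry
          (λ w rw w<y → augment te x rx m w rw (<-≤-trans w<y (≤-pred y<m)) i)

  terraced⇒deltaMatroid : Terraced F → IsDeltaMatroid R
  terraced⇒deltaMatroid te x y rx ry = augment te x rx (suc (distance x y)) y ry ≤-refl

lemma18 : (n : ℕ) (R : Pred (Config n) 0ℓ) (R? : Decidable R) →
          IsDeltaMatroid R ⇔ Terraced (indicator R?)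
lemma18 n R R? = mk⇔ (deltaMatroid⇒terraced R?) (terraced⇒deltaMatroid R?)
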